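{- A $d$-dimensional $(0,1)$-matrix of order $2$ is extremal if and only if it is antipodal and contains no polydiagonal.
   Context: A $d$-dimensional matrix of order $2$ is an array $(a_\alpha)_{\alpha\in\{1,2\}^d}$; $\mathrm{supp}(A)=\{\alpha:a_\alpha\ne0\}$; the hyperplane $\Gamma_{i,j}$ is the set of indices with $\alpha_i=j$. For $\alpha\in\{1,2\}^d$ its antipodal index is $\overline\alpha$ with $\overline\alpha_i=3-\alpha_i$ for all $i$. A $(0,1)$-matrix $A$ of order $2$ is antipodal if $a_\alpha\ne a_{\overline\alpha}$ for every $\alpha$. A polyplex of weight $W$ is a nonnegative matrix $K$ whose entries sum to at most $1$ over each hyperplane and to $W$ in total; a polydiagonal in a matrix of order $2$ is a polyplex of weight $2$. A $(0,1)$-matrix $A$ contains $K$ if $\mathrm{supp}(K)\subseteq\mathrm{supp}(A)$. A $(0,1)$-matrix $A$ is extremal if it contains no polydiagonal, but for every $\alpha$ with $a_\alpha=0$ the matrix obtained by changing $a_\alpha$ to $1$ contains a polydiagonal.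
   Formalization: The entries of polyplexes, and so of polydiagonals, are rational rather than real. -}

module Defs where

open import Data.Bool using (Bool; true; false; not; if_then_else_)
open import Data.Bool.Properties using () renaming (_≟_ to _≟𝔹_)
open import Data.Nat using (ℕ; zero; suc)
open import Data.Fin using (Fin)
open import Data.Vec using (Vec; []; _∷_; lookup) renaming (map to vmap)
open import Data.Vec.Properties using (≡-dec)
open import Data.List using (List; []; _∷_; _++_; map; foldr)
open import Data.Rational using (ℚ; 0ℚ; 1ℚ; _+_; _≤_)
open import Data.Product using (Σ; _×_)
open import Relation.Binary.PropositionalEquality using (_≡_; _≢_)
open import Relation.Nullary using (¬_; yes; no; does)

-- Index set {1,2}^d, encoded as Vec Bool d (false ~ 1, true ~ 2).
Index : ℕ → Set
Index d = Vec Bool d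

antipode : ∀ {d} → Index d → Index d
antipode = vmap not

allIdx : (d : ℕ) → List (Index d)
allIdx zero = [] ∷ []
allIdx (suc d) = map (false ∷_) (allIdx d) ++ map (true ∷_) (allIdx d)

BoolMatrix : ℕ → Set
BoolMatrix d = Index d → Bool

QMatrix : ℕ → Set
QMatrix d = Index d → ℚ

sumℚ : List ℚ → ℚ
sumℚ = foldr _+_ 0ℚ

total : ∀ {d} → QMatrix d → ℚ
total {d} K = sumℚ (map K (allIdx d))

hyperSum : ∀ {d} → QMatrix d → Fin d → Bool → ℚ
hyperSum {d} K i j =
  sumℚ (map (λ α → if does (lookup α i ≟𝔹 j) then K α else 0ℚ) (allIdx d))

IsPolyplex : ∀ {d} → ℚ → QMatrix d → Set
IsPolyplex {d} W K =
  ((α : Index d) → 0ℚ ≤ K α) ×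
  ((i : Fin d) (j : Bool) → hyperSum K i j ≤ 1ℚ) ×
  (total K ≡ W)

IsPolydiagonal : ∀ {d} → QMatrix d → Set
IsPolydiagonal K = IsPolyplex (1ℚ + 1ℚ) K

Contains : ∀ {d} → BoolMatrix d → QMatrix d → Set
Contains {d} A K = (α : Index d) → K α ≢ 0ℚ → A α ≡ true

ContainsPolydiagonal : ∀ {d} → BoolMatrix d → Set
ContainsPolydiagonal {d} A = Σ (QMatrix d) λ K → IsPolydiagonal K × Contains A K

setOne : ∀ {d} → BoolMatrix d → Index d → BoolMatrix d
setOne A α β with ≡-dec _≟𝔹_ β α
... | yes _ = true
... | no _ = A β

IsAntipodal : ∀ {d} → BoolMatrix d → Set
IsAntipodal {d} A = (α : Index d) → A α ≢ A (antipode α)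

IsExtremal : ∀ {d} → BoolMatrix d → Set
IsExtremal {d} A =
  ¬ ContainsPolydiagonal A ×
  ((α : Index d) → A α ≡ false → ContainsPolydiagonal (setOne A α))

-- If A is extremal but A α = A ᾱ = 0, setting either entry to 1 creates a
-- polydiagonal, K and K′, with s = K α and t = K′ ᾱ positive (otherwise it
-- already lies in A).  Deleting those entries and normalising t K₀ + s K′₀ by
-- s + t − st gives a polydiagonal inside A, because every hyperplane contains
-- exactly one of α and ᾱ.  For the same reason δ_α + δ_ᾱ is a polydiagonal, so
-- A α = A ᾱ = 1 is impossible as well, and it is the polydiagonal created by
-- adding a missing entry of an antipodal A.
module Submission where

open import Defs
open import Data.Bool using (Bool; true; false; not; if_then_else_)
open import Data.Bool.Properties using (¬-not; not-¬) renaming (_≟_ to _≟𝔹_)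
open import Data.Empty using (⊥-elim)
open import Data.Fin using (Fin; zero)
open import Data.List using (List; []; _∷_; _++_; map)
open import Data.Maybe using (Maybe; just; nothing)
open import Data.Nat as ℕ using (ℕ; suc)
open import Data.Product using (_×_; _,_; proj₁; proj₂)
open import Data.Rational
  using (ℚ; 0ℚ; 1ℚ; _+_; _*_; -_; _-_; _≤_; 1/_; NonNegative; NonZero; Positive; nonNegative; ≢-nonZero)
import Data.Rational.Properties as ℚ
open import Data.Vec using ([]; _∷_; lookup)
open import Data.Vec.Properties using (≡-dec; ∷-injectiveˡ; ∷-injectiveʳ; lookup-map)
open import Function using (_∘_)
open import Function.Bundles using (_⇔_; mk⇔)
open import Level using (0ℓ)
open import Relation.Binary.Definitions using (DecidableEquality)
open import Relation.Binary.PropositionalEquality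
open import Relation.Nullary using (¬_; Dec; yes; no; does)
open import Relation.Nullary.Decidable using (dec-true)
open import Tactic.RingSolver using (solve-∀)
open import Tactic.RingSolver.Core.AlmostCommutativeRing using (AlmostCommutativeRing; fromCommutativeRing)

ℚ-ring : AlmostCommutativeRing 0ℓ 0ℓ
ℚ-ring = fromCommutativeRing ℚ.+-*-commutativeRing zero?
  where
  zero? : ∀ x → Maybe (0ℚ ≡ x)
  zero? x with 0ℚ ℚ.≟ x
  ... | yes 0≡x = just 0≡x
  ... | no _ = nothing

private
  variable
    A : Set
    d : ℕ
    f g : A → ℚ

∑ : (A → ℚ) → List A → ℚ
∑ f xs = sumℚ (map f xs)

∑-cong : (∀ x → f x ≡ g x) → ∀ xs → ∑ f xs ≡ ∑ g xs
∑-cong f≡g [] = refl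
∑-cong f≡g (x ∷ xs) = cong₂ _+_ (f≡g x) (∑-cong f≡g xs)

∑-zero : (∀ x → f x ≡ 0ℚ) → ∀ xs → ∑ f xs ≡ 0ℚ
∑-zero f≡0 [] = refl
∑-zero f≡0 (x ∷ xs) = cong₂ _+_ (f≡0 x) (∑-zero f≡0 xs)

∑-++ : ∀ xs ys → ∑ f (xs ++ ys) ≡ ∑ f xs + ∑ f ys
∑-++ [] ys = sym (ℚ.+-identityˡ _)
∑-++ {f = f} (x ∷ xs) ys = trans (cong (f x +_) (∑-++ xs ys)) (sym (ℚ.+-assoc (f x) _ _))

∑-map : ∀ {B : Set} (h : B → A) xs → ∑ f (map h xs) ≡ ∑ (f ∘ h) xs
∑-map h [] = refl
∑-map {f = f} h (x ∷ xs) = cong (f (h x) +_) (∑-map h xs)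

∑-+ : ∀ xs → ∑ (λ x → f x + g x) xs ≡ ∑ f xs + ∑ g xs
∑-+ [] = refl
∑-+ {f = f} {g = g} (x ∷ xs) = trans (cong (f x + g x +_) (∑-+ xs))
  (interchange (f x) (g x) (∑ f xs) (∑ g xs))
  where
  interchange : ∀ a b c d → (a + b) + (c + d) ≡ (a + c) + (b + d)
  interchange = solve-∀ ℚ-ring

∑-*ˡ : ∀ c xs → ∑ (λ x → c * f x) xs ≡ c * ∑ f xs
∑-*ˡ c [] = sym (ℚ.*-zeroʳ c)
∑-*ˡ {f = f} c (x ∷ xs) = trans (cong (c * f x +_) (∑-*ˡ c xs)) (sym (ℚ.*-distribˡ-+ c (f x) _))

∑-nonneg : (∀ x → 0ℚ ≤ f x) → ∀ xs → 0ℚ ≤ ∑ f xs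
∑-nonneg f≥0 [] = ℚ.≤-refl
∑-nonneg f≥0 (x ∷ xs) = ℚ.+-mono-≤ (f≥0 x) (∑-nonneg f≥0 xs)

NonNegativeMatrix : QMatrix d → Set
NonNegativeMatrix K = ∀ α → 0ℚ ≤ K α

_⊕_ : QMatrix d → QMatrix d → QMatrix d
(K ⊕ L) β = K β + L β

_⊛_ : ℚ → QMatrix d → QMatrix d
(c ⊛ K) β = c * K β

infixl 6 _⊕_
infixl 7 _⊛_

⊕-nonneg : {K L : QMatrix d} → NonNegativeMatrix K → NonNegativeMatrix L → NonNegativeMatrix (K ⊕ L)
⊕-nonneg K≥0 L≥0 β = ℚ.+-mono-≤ (K≥0 β) (L≥0 β)

⊛-nonneg : ∀ {c} {K : QMatrix d} → 0ℚ ≤ c → NonNegativeMatrix K → NonNegativeMatrix (c ⊛ K)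
⊛-nonneg {c = c} {K} c≥0 K≥0 β = ℚ.nonNegative⁻¹ (c * K β)
  {{ℚ.nonNeg*nonNeg⇒nonNeg c {{nonNegative c≥0}} (K β) {{nonNegative (K≥0 β)}}}}

total-cong : {K L : QMatrix d} → (∀ β → K β ≡ L β) → total K ≡ total L
total-cong {d} K≡L = ∑-cong K≡L (allIdx d)

total-⊕ : (K L : QMatrix d) → total (K ⊕ L) ≡ total K + total L
total-⊕ {d} K L = ∑-+ (allIdx d)

total-⊛ : ∀ c (K : QMatrix d) → total (c ⊛ K) ≡ c * total K
total-⊛ {d} c K = ∑-*ˡ c (allIdx d)

total-nonneg : {K : QMatrix d} → NonNegativeMatrix K → 0ℚ ≤ total K
total-nonneg {d} K≥0 = ∑-nonneg K≥0 (allIdx d)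

total-∷ : (K : QMatrix (suc d)) → total K ≡ total (K ∘ (false ∷_)) + total (K ∘ (true ∷_))
total-∷ {d} K = trans (∑-++ (map (false ∷_) (allIdx d)) _)
  (cong₂ _+_ (∑-map {f = K} _ (allIdx d)) (∑-map {f = K} _ (allIdx d)))

-- hyperSum K i j is definitionally total (onHyperplane i j K).
onHyperplane : Fin d → Bool → QMatrix d → QMatrix d
onHyperplane i j K β = if does (lookup β i ≟𝔹 j) then K β else 0ℚ

onHyperplane-nonneg : ∀ i j {K : QMatrix d} → NonNegativeMatrix K → NonNegativeMatrix (onHyperplane i j K)
onHyperplane-nonneg i j K≥0 β with does (lookup β i ≟𝔹 j)
... | true = K≥0 β
... | false = ℚ.≤-refl

hyperSum-⊕ : (K L : QMatrix d) → ∀ i j → hyperSum (K ⊕ L) i j ≡ hyperSum K i j + hyperSum L i j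
hyperSum-⊕ K L i j = trans (total-cong λ β → split (does (lookup β i ≟𝔹 j)))
  (total-⊕ (onHyperplane i j K) (onHyperplane i j L))
  where
  split : ∀ b {x y} → (if b then x + y else 0ℚ) ≡ (if b then x else 0ℚ) + (if b then y else 0ℚ)
  split true = refl
  split false = refl

hyperSum-⊛ : ∀ c (K : QMatrix d) i j → hyperSum (c ⊛ K) i j ≡ c * hyperSum K i j
hyperSum-⊛ c K i j = trans (total-cong λ β → scale (does (lookup β i ≟𝔹 j)))
  (total-⊛ c (onHyperplane i j K))
  where
  scale : ∀ b {x} → (if b then c * x else 0ℚ) ≡ c * (if b then x else 0ℚ)
  scale true = refl
  scale false = sym (ℚ.*-zeroʳ c)

_≟ᵢ_ : DecidableEquality (Index d)
_≟ᵢ_ = ≡-dec _≟𝔹_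

antipode-≢ : (α : Index (suc d)) → antipode α ≢ α
antipode-≢ (b ∷ α) eq = not-¬ refl (sym (∷-injectiveˡ eq))

δ : Index d → QMatrix d
δ α β = if does (β ≟ᵢ α) then 1ℚ else 0ℚ

δ-self : (α : Index d) → δ α α ≡ 1ℚ
δ-self α with α ≟ᵢ α
... | yes _ = refl
... | no α≢α = ⊥-elim (α≢α refl)

δ-other : {α β : Index d} → β ≢ α → δ α β ≡ 0ℚ
δ-other {α = α} {β} β≢α with β ≟ᵢ α
... | yes β≡α = ⊥-elim (β≢α β≡α)
... | no _ = refl

δ-nonneg : (α : Index d) → NonNegativeMatrix (δ α)
δ-nonneg α β with β ≟ᵢ α
... | yes _ = ℚ.nonNegative⁻¹ 1ℚ
... | no _ = ℚ.≤-refl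

total-supported : (K : QMatrix d) (α : Index d) → (∀ β → β ≢ α → K β ≡ 0ℚ) → total K ≡ K α
total-supported {ℕ.zero} K [] _ = ℚ.+-identityʳ (K [])
total-supported {suc d} K (false ∷ α) K≡0 = begin
  total K                                       ≡⟨ total-∷ K ⟩
  total (K ∘ (false ∷_)) + total (K ∘ (true ∷_)) ≡⟨ cong₂ _+_ (total-supported _ α λ β β≢α → K≡0 _ (β≢α ∘ ∷-injectiveʳ))
                                                                (∑-zero (λ β → K≡0 _ λ ()) (allIdx d)) ⟩
  K (false ∷ α) + 0ℚ                            ≡⟨ ℚ.+-identityʳ _ ⟩
  K (false ∷ α)                                 ∎
  where open ≡-Reasoning
total-supported {suc d} K (true ∷ α) K≡0 = begin
  total K                                       ≡⟨ total-∷ K ⟩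
  total (K ∘ (false ∷_)) + total (K ∘ (true ∷_)) ≡⟨ cong₂ _+_ (∑-zero (λ β → K≡0 _ λ ()) (allIdx d))
                                                                (total-supported _ α λ β β≢α → K≡0 _ (β≢α ∘ ∷-injectiveʳ)) ⟩
  0ℚ + K (true ∷ α)                             ≡⟨ ℚ.+-identityˡ _ ⟩
  K (true ∷ α)                                  ∎
  where open ≡-Reasoning

total-δ : (α : Index d) → total (δ α) ≡ 1ℚ
total-δ α = trans (total-supported (δ α) α λ _ → δ-other) (δ-self α)

hyperSum-δ : (α : Index d) → ∀ i j → hyperSum (δ α) i j ≡ (if does (lookup α i ≟𝔹 j) then 1ℚ else 0ℚ)
hyperSum-δ α i j = trans (total-supported _ α vanish) (cong (λ x → if does (lookup α i ≟𝔹 j) then x else 0ℚ) (δ-self α))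
  where
  vanish : ∀ β → β ≢ α → onHyperplane i j (δ α) β ≡ 0ℚ
  vanish β β≢α rewrite δ-other β≢α with does (lookup β i ≟𝔹 j)
  ... | true = refl
  ... | false = refl

antipodalPair : Index d → QMatrix d
antipodalPair α = δ α ⊕ δ (antipode α)

hyperSum-antipodalPair : (α : Index d) → ∀ i j → hyperSum (antipodalPair α) i j ≡ 1ℚ
hyperSum-antipodalPair α i j = begin
  hyperSum (antipodalPair α) i j                         ≡⟨ hyperSum-⊕ (δ α) (δ (antipode α)) i j ⟩
  hyperSum (δ α) i j + hyperSum (δ (antipode α)) i j     ≡⟨ cong₂ _+_ (hyperSum-δ α i j) (hyperSum-δ (antipode α) i j) ⟩
  indicator j a + indicator j (lookup (antipode α) i)    ≡⟨ cong (λ b → indicator j a + indicator j b) (lookup-map i not α) ⟩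
  indicator j a + indicator j (not a)                    ≡⟨ exactlyOne a j ⟩
  1ℚ                                                     ∎
  where
  open ≡-Reasoning
  a : Bool
  a = lookup α i
  indicator : Bool → Bool → ℚ
  indicator j b = if does (b ≟𝔹 j) then 1ℚ else 0ℚ
  exactlyOne : ∀ b j → indicator j b + indicator j (not b) ≡ 1ℚ
  exactlyOne false false = refl
  exactlyOne false true = refl
  exactlyOne true false = refl
  exactlyOne true true = refl

antipodalPair-polydiagonal : (α : Index d) → IsPolydiagonal (antipodalPair α)
antipodalPair-polydiagonal α =
  ⊕-nonneg (δ-nonneg α) (δ-nonneg (antipode α)) ,
  (λ i j → ℚ.≤-reflexive (hyperSum-antipodalPair α i j)) ,
  trans (total-⊕ (δ α) (δ (antipode α))) (cong₂ _+_ (total-δ α) (total-δ (antipode α)))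

setOne-self : (B : BoolMatrix d) (α : Index d) → setOne B α α ≡ true
setOne-self B α with α ≟ᵢ α
... | yes _ = refl
... | no α≢α = ⊥-elim (α≢α refl)

setOne-other : (B : BoolMatrix d) {α β : Index d} → β ≢ α → setOne B α β ≡ B β
setOne-other B {α} {β} β≢α with β ≟ᵢ α
... | yes β≡α = ⊥-elim (β≢α β≡α)
... | no _ = refl

Contains-setOne⁻ : (B : BoolMatrix d) {α : Index d} {K : QMatrix d} →
  K α ≡ 0ℚ → Contains (setOne B α) K → Contains B K
Contains-setOne⁻ B {α} Kα≡0 K⊆B+α β Kβ≢0 with β ≟ᵢ α
... | yes refl = ⊥-elim (Kβ≢0 Kα≡0)
... | no β≢α = trans (sym (setOne-other B β≢α)) (K⊆B+α β Kβ≢0)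

Contains-⊕ : {B : BoolMatrix d} {K L : QMatrix d} → Contains B K → Contains B L → Contains B (K ⊕ L)
Contains-⊕ {K = K} K⊆B L⊆B β K+L≢0 with K β ℚ.≟ 0ℚ
... | no Kβ≢0 = K⊆B β Kβ≢0
... | yes Kβ≡0 = L⊆B β λ Lβ≡0 → K+L≢0 (cong₂ _+_ Kβ≡0 Lβ≡0)

Contains-⊛ : {B : BoolMatrix d} (c : ℚ) {K : QMatrix d} → Contains B K → Contains B (c ⊛ K)
Contains-⊛ c K⊆B β cK≢0 = K⊆B β λ Kβ≡0 → cK≢0 (trans (cong (c *_) Kβ≡0) (ℚ.*-zeroʳ c))

Contains-antipodalPair : (B : BoolMatrix d) {α : Index d} →
  B α ≡ true → B (antipode α) ≡ true → Contains B (antipodalPair α)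
Contains-antipodalPair B {α} Bα≡1 Bᾱ≡1 β pairβ≢0 with β ≟ᵢ α | β ≟ᵢ antipode α
... | yes refl | _ = Bα≡1
... | no _ | yes refl = Bᾱ≡1
... | no _ | no _ = ⊥-elim (pairβ≢0 refl)

ContainsPolydiagonal-antipodalPair : (B : BoolMatrix d) (α : Index d) →
  B α ≡ true → B (antipode α) ≡ true → ContainsPolydiagonal B
ContainsPolydiagonal-antipodalPair B α Bα≡1 Bᾱ≡1 =
  antipodalPair α , antipodalPair-polydiagonal α , Contains-antipodalPair B Bα≡1 Bᾱ≡1

erase : Index d → QMatrix d → QMatrix d
erase α K = K ⊕ (- K α) ⊛ δ α

erase-self : (α : Index d) (K : QMatrix d) → erase α K α ≡ 0ℚ
erase-self α K = trans (cong (λ x → K α + - K α * x) (δ-self α)) (cancel (K α))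
  where
  cancel : ∀ x → x + - x * 1ℚ ≡ 0ℚ
  cancel = solve-∀ ℚ-ring

erase-other : {α β : Index d} (K : QMatrix d) → β ≢ α → erase α K β ≡ K β
erase-other {α = α} {β} K β≢α = trans (cong (λ x → K β + - K α * x) (δ-other β≢α)) (unchanged (K β) (K α))
  where
  unchanged : ∀ x y → x + - y * 0ℚ ≡ x
  unchanged = solve-∀ ℚ-ring

erase-nonneg : (α : Index d) {K : QMatrix d} → NonNegativeMatrix K → NonNegativeMatrix (erase α K)
erase-nonneg α {K} K≥0 β = byCases (β ≟ᵢ α)
  where
  byCases : Dec (β ≡ α) → 0ℚ ≤ erase α K β
  byCases (yes refl) = ℚ.≤-reflexive (sym (erase-self α K))
  byCases (no β≢α) = subst (0ℚ ≤_) (sym (erase-other K β≢α)) (K≥0 β)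

Contains-erase : (B : BoolMatrix d) {α : Index d} {K : QMatrix d} →
  Contains (setOne B α) K → Contains B (erase α K)
Contains-erase B {α} {K} K⊆B+α β erasedβ≢0 = byCases (β ≟ᵢ α)
  where
  byCases : Dec (β ≡ α) → B β ≡ true
  byCases (yes refl) = ⊥-elim (erasedβ≢0 (erase-self α K))
  byCases (no β≢α) = trans (sym (setOne-other B β≢α)) (K⊆B+α β λ Kβ≡0 → erasedβ≢0 (trans (erase-other K β≢α) Kβ≡0))

total-erase : (α : Index d) (K : QMatrix d) → total (erase α K) ≡ total K - K α
total-erase α K = begin
  total (erase α K)                 ≡⟨ total-⊕ K (- K α ⊛ δ α) ⟩
  total K + total (- K α ⊛ δ α)     ≡⟨ cong (total K +_) (total-⊛ (- K α) (δ α)) ⟩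
  total K + - K α * total (δ α)     ≡⟨ cong (λ x → total K + - K α * x) (total-δ α) ⟩
  total K + - K α * 1ℚ              ≡⟨ subtract (total K) (K α) ⟩
  total K - K α                     ∎
  where
  open ≡-Reasoning
  subtract : ∀ x y → x + - y * 1ℚ ≡ x - y
  subtract = solve-∀ ℚ-ring

hyperSum-erase : (α : Index d) (K : QMatrix d) → ∀ i j →
  hyperSum (erase α K) i j ≡ hyperSum K i j - K α * hyperSum (δ α) i j
hyperSum-erase α K i j = begin
  hyperSum (erase α K) i j                    ≡⟨ hyperSum-⊕ K (- K α ⊛ δ α) i j ⟩
  hyperSum K i j + hyperSum (- K α ⊛ δ α) i j ≡⟨ cong (hyperSum K i j +_) (hyperSum-⊛ (- K α) (δ α) i j) ⟩
  hyperSum K i j + - K α * hyperSum (δ α) i j ≡⟨ subtract (hyperSum K i j) (K α) (hyperSum (δ α) i j) ⟩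
  hyperSum K i j - K α * hyperSum (δ α) i j   ∎
  where
  open ≡-Reasoning
  subtract : ∀ x y z → x + - y * z ≡ x - y * z
  subtract = solve-∀ ℚ-ring

entry≤total : {K : QMatrix d} → NonNegativeMatrix K → ∀ α → K α ≤ total K
entry≤total {K = K} K≥0 α = begin
  K α                   ≡⟨ ℚ.+-identityˡ (K α) ⟨
  0ℚ + K α              ≤⟨ ℚ.+-monoˡ-≤ (K α) (subst (0ℚ ≤_) (total-erase α K) (total-nonneg (erase-nonneg α K≥0))) ⟩
  (total K - K α) + K α ≡⟨ restore (total K) (K α) ⟩
  total K               ∎
  where
  open ℚ.≤-Reasoning
  restore : ∀ x y → (x - y) + y ≡ x
  restore = solve-∀ ℚ-ring

entry≤1 : {K : QMatrix (suc d)} → IsPolydiagonal K → ∀ α → K α ≤ 1ℚ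
entry≤1 {K = K} (K≥0 , hyperSum≤1 , _) α = begin
  K α                      ≡⟨ cong (λ b → if b then K α else 0ℚ) (dec-true (lookup α zero ≟𝔹 lookup α zero) refl) ⟨
  onHyperplane zero a K α  ≤⟨ entry≤total (onHyperplane-nonneg zero a K≥0) α ⟩
  hyperSum K zero a        ≤⟨ hyperSum≤1 zero a ⟩
  1ℚ                       ∎
  where
  open ℚ.≤-Reasoning
  a : Bool
  a = lookup α zero

module Merge {A : BoolMatrix (suc d)} {α : Index (suc d)} {K K′ : QMatrix (suc d)}
  (K-poly : IsPolydiagonal K) (K⊆A+α : Contains (setOne A α) K)
  (K′-poly : IsPolydiagonal K′) (K′⊆A+ᾱ : Contains (setOne A (antipode α)) K′)
  (t≢0 : K′ (antipode α) ≢ 0ℚ) where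

  ᾱ : Index (suc d)
  ᾱ = antipode α

  K≥0 : NonNegativeMatrix K
  K≥0 = proj₁ K-poly
  K′≥0 : NonNegativeMatrix K′
  K′≥0 = proj₁ K′-poly

  s t w : ℚ
  s = K α
  t = K′ ᾱ
  w = t + s - s * t

  -- Positivity of t alone suffices: w = t + s (1 − t) ≥ t > 0.
  instance
    w-positive : Positive w
    w-positive = subst Positive (rearrange t s) (ℚ.pos+nonNeg⇒pos t {{t-positive}} (s * (1ℚ - t)) {{s[1-t]≥0}})
      where
      rearrange : ∀ t s → t + s * (1ℚ - t) ≡ t + s - s * t
      rearrange = solve-∀ ℚ-ring
      t-positive : Positive t
      t-positive = ℚ.nonNeg∧nonZero⇒pos t {{nonNegative (K′≥0 ᾱ)}} {{≢-nonZero t≢0}}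
      1-t≥0 : 0ℚ ≤ 1ℚ - t
      1-t≥0 = subst (_≤ 1ℚ - t) (ℚ.+-inverseʳ t) (ℚ.+-monoˡ-≤ (- t) (entry≤1 K′-poly ᾱ))
      s[1-t]≥0 : NonNegative (s * (1ℚ - t))
      s[1-t]≥0 = ℚ.nonNeg*nonNeg⇒nonNeg s {{nonNegative (K≥0 α)}} (1ℚ - t) {{nonNegative 1-t≥0}}
    w-nonZero : NonZero w
    w-nonZero = ℚ.pos⇒nonZero w

  e : ℚ
  e = 1/ w

  e≥0 : 0ℚ ≤ e
  e≥0 = ℚ.nonNegative⁻¹ e {{ℚ.pos⇒nonNeg e {{ℚ.1/pos⇒pos w}}}}

  K₀ K′₀ : QMatrix (suc d)
  K₀ = erase α K
  K′₀ = erase ᾱ K′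

  N : QMatrix (suc d)
  N = e ⊛ (t ⊛ K₀ ⊕ s ⊛ K′₀)

  N-nonneg : NonNegativeMatrix N
  N-nonneg = ⊛-nonneg e≥0 (⊕-nonneg (⊛-nonneg (K′≥0 ᾱ) (erase-nonneg α K≥0))
                                    (⊛-nonneg (K≥0 α) (erase-nonneg ᾱ K′≥0)))

  N⊆A : Contains A N
  N⊆A = Contains-⊛ e (Contains-⊕ (Contains-⊛ t (Contains-erase A K⊆A+α))
                               (Contains-⊛ s (Contains-erase A K′⊆A+ᾱ)))

  total-N : total N ≡ 1ℚ + 1ℚ
  total-N = begin
    total N                                      ≡⟨ total-⊛ e (t ⊛ K₀ ⊕ s ⊛ K′₀) ⟩
    e * total (t ⊛ K₀ ⊕ s ⊛ K′₀)                 ≡⟨ cong (e *_) (total-⊕ (t ⊛ K₀) (s ⊛ K′₀)) ⟩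
    e * (total (t ⊛ K₀) + total (s ⊛ K′₀))       ≡⟨ cong (e *_) (cong₂ _+_ (total-⊛ t K₀) (total-⊛ s K′₀)) ⟩
    e * (t * total K₀ + s * total K′₀)           ≡⟨ cong (e *_) (cong₂ (λ x y → t * x + s * y) (total-erase α K) (total-erase ᾱ K′)) ⟩
    e * (t * (total K - s) + s * (total K′ - t)) ≡⟨ cong₂ (λ x y → e * (t * (x - s) + s * (y - t))) (proj₂ (proj₂ K-poly)) (proj₂ (proj₂ K′-poly)) ⟩
    e * (t * (1ℚ + 1ℚ - s) + s * (1ℚ + 1ℚ - t))  ≡⟨ factor e t s ⟩
    (1ℚ + 1ℚ) * (e * w)                          ≡⟨ cong ((1ℚ + 1ℚ) *_) (ℚ.*-inverseˡ w) ⟩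
    (1ℚ + 1ℚ) * 1ℚ                               ≡⟨ ℚ.*-identityʳ _ ⟩
    1ℚ + 1ℚ                                      ∎
    where
    open ≡-Reasoning
    factor : ∀ e t s → e * (t * (1ℚ + 1ℚ - s) + s * (1ℚ + 1ℚ - t)) ≡ (1ℚ + 1ℚ) * (e * (t + s - s * t))
    factor = solve-∀ ℚ-ring

  hyperSum-N≤1 : ∀ i j → hyperSum N i j ≤ 1ℚ
  hyperSum-N≤1 i j = begin
    hyperSum N i j                                           ≡⟨ hyperSum-⊛ e (t ⊛ K₀ ⊕ s ⊛ K′₀) i j ⟩
    e * hyperSum (t ⊛ K₀ ⊕ s ⊛ K′₀) i j                      ≡⟨ cong (e *_) (hyperSum-⊕ (t ⊛ K₀) (s ⊛ K′₀) i j) ⟩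
    e * (hyperSum (t ⊛ K₀) i j + hyperSum (s ⊛ K′₀) i j)     ≡⟨ cong (e *_) (cong₂ _+_ (hyperSum-⊛ t K₀ i j) (hyperSum-⊛ s K′₀ i j)) ⟩
    e * (t * hyperSum K₀ i j + s * hyperSum K′₀ i j)         ≡⟨ cong (e *_) (cong₂ (λ x y → t * x + s * y) (hyperSum-erase α K i j) (hyperSum-erase ᾱ K′ i j)) ⟩
    e * (t * (hyperSum K i j - s * a) + s * (hyperSum K′ i j - t * b))
      ≤⟨ ℚ.*-monoˡ-≤-nonNeg e {{nonNegative e≥0}} (ℚ.+-mono-≤ (bound t (K′≥0 ᾱ) (proj₁ (proj₂ K-poly) i j))
                                                              (bound s (K≥0 α) (proj₁ (proj₂ K′-poly) i j))) ⟩
    e * (t * (1ℚ - s * a) + s * (1ℚ - t * b))                ≡⟨ cong (e *_) (expand t s a b) ⟩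
    e * (t + s - s * t * (a + b))                            ≡⟨ cong (λ x → e * (t + s - s * t * x)) a+b≡1 ⟩
    e * (t + s - s * t * 1ℚ)                                 ≡⟨ cong (λ x → e * (t + s - x)) (ℚ.*-identityʳ (s * t)) ⟩
    e * w                                                    ≡⟨ ℚ.*-inverseˡ w ⟩
    1ℚ                                                       ∎
    where
    open ℚ.≤-Reasoning
    a b : ℚ
    a = hyperSum (δ α) i j
    b = hyperSum (δ ᾱ) i j
    a+b≡1 : a + b ≡ 1ℚ
    a+b≡1 = trans (sym (hyperSum-⊕ (δ α) (δ ᾱ) i j)) (hyperSum-antipodalPair α i j)
    bound : ∀ c {x y} → 0ℚ ≤ c → x ≤ 1ℚ → c * (x - y) ≤ c * (1ℚ - y)
    bound c {y = y} c≥0 x≤1 = ℚ.*-monoˡ-≤-nonNeg c {{nonNegative c≥0}} (ℚ.+-monoˡ-≤ (- y) x≤1)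
    expand : ∀ t s a b → t * (1ℚ - s * a) + s * (1ℚ - t * b) ≡ t + s - s * t * (a + b)
    expand = solve-∀ ℚ-ring

  containsPolydiagonal : ContainsPolydiagonal A
  containsPolydiagonal = N , (N-nonneg , hyperSum-N≤1 , total-N) , N⊆A

ContainsPolydiagonal-merge : (A : BoolMatrix (suc d)) (α : Index (suc d)) →
  ContainsPolydiagonal (setOne A α) → ContainsPolydiagonal (setOne A (antipode α)) → ContainsPolydiagonal A
ContainsPolydiagonal-merge A α (K , K-poly , K⊆A+α) (K′ , K′-poly , K′⊆A+ᾱ) with K′ (antipode α) ℚ.≟ 0ℚ
... | yes t≡0 = K′ , K′-poly , Contains-setOne⁻ A t≡0 K′⊆A+ᾱ
... | no t≢0 = Merge.containsPolydiagonal K-poly K⊆A+α K′-poly K′⊆A+ᾱ t≢0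

Extremal⇒Antipodal : (A : BoolMatrix (suc d)) → IsExtremal A → IsAntipodal A
Extremal⇒Antipodal A (noPoly , addPoly) α Aα≡Aᾱ = noPoly (byValue (A α) refl)
  where
  byValue : ∀ b → A α ≡ b → ContainsPolydiagonal A
  byValue true Aα≡1 = ContainsPolydiagonal-antipodalPair A α Aα≡1 (trans (sym Aα≡Aᾱ) Aα≡1)
  byValue false Aα≡0 = ContainsPolydiagonal-merge A α (addPoly α Aα≡0) (addPoly (antipode α) (trans (sym Aα≡Aᾱ) Aα≡0))

Antipodal⇒Extremal : (A : BoolMatrix (suc d)) → IsAntipodal A → ¬ ContainsPolydiagonal A → IsExtremal A
Antipodal⇒Extremal A antipodal noPoly = noPoly , λ α Aα≡0 →
  ContainsPolydiagonal-antipodalPair (setOne A α) α (setOne-self A α)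
    (trans (setOne-other A (antipode-≢ α)) (trans (¬-not (antipodal α ∘ sym)) (cong not Aα≡0)))

theorem8p1 : (d : ℕ) (A : BoolMatrix (suc d)) →
    IsExtremal A ⇔ (IsAntipodal A × ¬ ContainsPolydiagonal A)
theorem8p1 d A = mk⇔
  (λ extremal → Extremal⇒Antipodal A extremal , proj₁ extremal)
  (λ (antipodal , noPoly) → Antipodal⇒Extremal A antipodal noPoly)
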